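{- Let $G$ be a finite, simple, connected graph which is $3$-$\gamma_{c}$-critical. Then $\alpha(G) \leq \kappa(G) + 2$.
   Context: All graphs are finite, simple and connected. A set $D \subseteq V(G)$ is a connected dominating set of $G$ if every vertex of $G$ is in $D$ or adjacent to a vertex of $D$, and the induced subgraph $G[D]$ is connected; the connected domination number $\gamma_{c}(G)$ is the minimum size of such a set. For non-adjacent vertices $u,v$, $G+uv$ denotes $G$ with the edge $uv$ added. $G$ is $3$-$\gamma_{c}$-critical if $\gamma_{c}(G)=3$ and $\gamma_{c}(G+uv)<3$ for every pair of non-adjacent vertices $u,v$ of $G$. $\alpha(G)$ is the independence number (maximum size of a set of pairwise non-adjacent vertices), $\delta(G)$ the minimum degree, and $\kappa(G)$ the connectivity, i.e. the minimum size of a vertex cut set (a set $S$ of vertices with $G-S$ disconnected). -}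

module Defs where

open import Data.Nat using (ℕ; _≤_; _<_)
open import Data.Bool using (Bool; true; false; _∨_; _∧_)
open import Data.Fin using (Fin; _≟_)
open import Data.Fin.Subset using (Subset; _∈_; _∉_; ∣_∣; ∁)
open import Data.Product using (Σ; ∃; ∃-syntax; _×_)
open import Data.Sum using (_⊎_)
open import Relation.Nullary using (¬_; does)
open import Relation.Binary.PropositionalEquality using (_≡_; _≢_)

Graph : ℕ → Set
Graph n = Fin n → Fin n → Bool

IsSimple : ∀ {n} → Graph n → Set
IsSimple G = (∀ x y → G x y ≡ G y x) × (∀ x → G x x ≡ false)

_~[_]_ : ∀ {n} → Fin n → Graph n → Fin n → Set
u ~[ G ] v = G u v ≡ true

-- Reachability inside the subgraph induced by S (walks using only vertices of S)
data Reach {n} (G : Graph n) (S : Subset n) : Fin n → Fin n → Set where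
  here : ∀ {u} → u ∈ S → Reach G S u u
  step : ∀ {u w v} → u ∈ S → u ~[ G ] w → Reach G S w v → Reach G S u v

ConnectedOn : ∀ {n} → Graph n → Subset n → Set
ConnectedOn G S = ∀ u v → u ∈ S → v ∈ S → Reach G S u v

full : ∀ {n} → Subset n
full {n} = Data.Fin.Subset.⊤

Connected : ∀ {n} → Graph n → Set
Connected G = ConnectedOn G full

Dominating : ∀ {n} → Graph n → Subset n → Set
Dominating G D = ∀ v → v ∈ D ⊎ (∃[ u ] (u ∈ D × v ~[ G ] u))

IsCDS : ∀ {n} → Graph n → Subset n → Set
IsCDS G D = Dominating G D × ConnectedOn G D

ConnDomNumber : ∀ {n} → Graph n → ℕ → Set
ConnDomNumber G k =
  (∃[ D ] (IsCDS G D × ∣ D ∣ ≡ k)) × (∀ D → IsCDS G D → k ≤ ∣ D ∣)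

addEdge : ∀ {n} → Graph n → Fin n → Fin n → Graph n
addEdge G u v x y =
  G x y ∨ (does (x ≟ u) ∧ does (y ≟ v)) ∨ (does (x ≟ v) ∧ does (y ≟ u))

Is3CCritical : ∀ {n} → Graph n → Set
Is3CCritical {n} G =
  ConnDomNumber G 3 ×
  (∀ (u v : Fin n) → u ≢ v → G u v ≡ false →
     ∃[ k ] (k < 3 × ConnDomNumber (addEdge G u v) k))

Independent : ∀ {n} → Graph n → Subset n → Set
Independent G I = ∀ u v → u ∈ I → v ∈ I → G u v ≡ false

IndepNumber : ∀ {n} → Graph n → ℕ → Set
IndepNumber G a =
  (∃[ I ] (Independent G I × ∣ I ∣ ≡ a)) × (∀ I → Independent G I → ∣ I ∣ ≤ a)

-- S is a vertex cut set: G - S is disconnected, i.e. there are two vertices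
-- outside S not joined by a walk avoiding S
IsCutSet : ∀ {n} → Graph n → Subset n → Set
IsCutSet G S = ∃[ u ] ∃[ v ] (u ∉ S × v ∉ S × ¬ Reach G (∁ S) u v)

Connectivity : ∀ {n} → Graph n → ℕ → Set
Connectivity G k =
  (∃[ S ] (IsCutSet G S × ∣ S ∣ ≡ k)) × (∀ S → IsCutSet G S → k ≤ ∣ S ∣)

{-# OPTIONS --safe #-}
-- Let S be a vertex cut and I an independent set. For non-adjacent u, v,
-- a connected dominating set of G + uv with at most two vertices shows that either {u, v}
-- dominates G, or u has a neighbour x ≁ v such that {u, x} dominates G − v (or the same
-- with u and v exchanged). Send each v ∈ I ∩ S to itself, and each v ∈ I ∖ S that has one
-- to a vertex of S ∖ I adjacent to exactly the vertices of I ∖ S other than v; this is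
-- injective into S.
-- At most two vertices of I are left over: for three of them, criticality applied to
-- their pairs yields two dominating edges outside S, and these connect all of G − S.
module Submission where

open import Defs
open import Data.Bool using (true; false)
import Data.Bool as Bool
open import Data.Bool.Properties using (not-¬; ¬-not)
open import Data.Empty using (⊥; ⊥-elim)
open import Data.Fin using (Fin; zero; suc; _≟_)
open import Data.Fin.Properties using (any?; all?; suc-injective; 0≢1+n)
open import Data.Fin.Subset using (Subset; inside; outside; _∈_; _∉_; ∣_∣; ∁; _-_; ⊤; ⁅_⁆; _∪_)
open import Data.Fin.Subset.Properties
  using (_∈?_; x∈p⇒∣p-x∣<∣p∣; x∈p∧x≢y⇒x∈p-y; x∉p⇒x∈∁p; ∈⊤; x∈⁅x⁆; x∈⁅y⁆⇒x≡y; x∈p∪q⁺; x∈p∪q⁻)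
open import Data.Nat using (ℕ; _≤_; _<_; _+_; z≤n; s≤s)
open import Data.Nat.Properties using (≤-trans; ≤⇒≯; +-comm; module ≤-Reasoning)
open import Data.Product using (Σ-syntax; ∃-syntax; _×_; _,_; proj₁; proj₂)
open import Data.Sum using (_⊎_; inj₁; inj₂)
open import Data.Vec.Base using ([]; _∷_)
import Data.Vec.Base as Vec
open import Function using (_∘_; case_of_)
open import Relation.Nullary using (¬_; Dec; yes; no; does; ¬?; _×-dec_; _→-dec_)
open import Relation.Unary using (Decidable)
open import Relation.Binary.PropositionalEquality using (_≡_; _≢_; refl; sym; trans; subst; ≢-sym)

AtMostTwo : ∀ {n} → (Fin n → Set) → Set
AtMostTwo E = ∀ {i j k} → E i → E j → E k → i ≢ j → i ≢ k → j ≢ k → ⊥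

injective-relation⇒∣p∣≤∣q∣ : ∀ {n m} (p : Subset n) (q : Subset m) (R : Fin n → Fin m → Set) →
  (∀ i → i ∈ p → ∃[ x ] (x ∈ q × R i x)) → (∀ {i j x} → R i x → R j x → i ≡ j) →
  ∣ p ∣ ≤ ∣ q ∣
injective-relation⇒∣p∣≤∣q∣ [] q R total injective = z≤n
injective-relation⇒∣p∣≤∣q∣ (outside ∷ p) q R total injective =
  injective-relation⇒∣p∣≤∣q∣ p q (R ∘ suc) (λ i i∈p → total (suc i) (Vec.there i∈p))
    (λ r r′ → suc-injective (injective r r′))
injective-relation⇒∣p∣≤∣q∣ (inside ∷ p) q R total injective with total zero Vec.here
... | x , x∈q , R0x = ≤-trans (s≤s ∣p∣≤∣q-x∣) (x∈p⇒∣p-x∣<∣p∣ x∈q)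
  where
  total′ : ∀ i → i ∈ p → ∃[ y ] (y ∈ q - x × R (suc i) y)
  total′ i i∈p with total (suc i) (Vec.there i∈p)
  ... | y , y∈q , Riy = y , x∈p∧x≢y⇒x∈p-y y∈q (λ { refl → 0≢1+n (injective R0x Riy) }) , Riy

  ∣p∣≤∣q-x∣ : ∣ p ∣ ≤ ∣ q - x ∣
  ∣p∣≤∣q-x∣ = injective-relation⇒∣p∣≤∣q∣ p (q - x) (R ∘ suc) total′
    (λ r r′ → suc-injective (injective r r′))

three-distinct⇒3≤∣p∣ : ∀ {n} {p : Subset n} {i j k} → i ∈ p → j ∈ p → k ∈ p →
  i ≢ j → i ≢ k → j ≢ k → 3 ≤ ∣ p ∣
three-distinct⇒3≤∣p∣ {p = p} {i} {j} {k} i∈p j∈p k∈p i≢j i≢k j≢k = begin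
  3                     ≤⟨ s≤s (s≤s (s≤s z≤n)) ⟩
  3 + ∣ p - i - j - k ∣ ≤⟨ s≤s (s≤s (x∈p⇒∣p-x∣<∣p∣ k∈p-i-j)) ⟩
  2 + ∣ p - i - j ∣     ≤⟨ s≤s (x∈p⇒∣p-x∣<∣p∣ j∈p-i) ⟩
  1 + ∣ p - i ∣         ≤⟨ x∈p⇒∣p-x∣<∣p∣ i∈p ⟩
  ∣ p ∣                 ∎
  where
  open ≤-Reasoning
  j∈p-i : j ∈ p - i
  j∈p-i = x∈p∧x≢y⇒x∈p-y j∈p (≢-sym i≢j)
  k∈p-i-j : k ∈ p - i - j
  k∈p-i-j = x∈p∧x≢y⇒x∈p-y (x∈p∧x≢y⇒x∈p-y k∈p (≢-sym i≢k)) (≢-sym j≢k)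

∣p∣≤2⇒atMostTwo : ∀ {n} {p : Subset n} → ∣ p ∣ ≤ 2 → AtMostTwo (_∈ p)
∣p∣≤2⇒atMostTwo ∣p∣≤2 i∈p j∈p k∈p i≢j i≢k j≢k =
  ≤⇒≯ ∣p∣≤2 (three-distinct⇒3≤∣p∣ i∈p j∈p k∈p i≢j i≢k j≢k)

∣p∣≤2⇒covered : ∀ {n} {p : Subset n} {a b} → ∣ p ∣ ≤ 2 → a ∈ p → b ∈ p → a ≢ b →
  ∀ y → y ∈ p → y ≡ a ⊎ y ≡ b
∣p∣≤2⇒covered {a = a} {b} ∣p∣≤2 a∈p b∈p a≢b y y∈p with y ≟ a | y ≟ b
... | yes y≡a | _       = inj₁ y≡a
... | no _    | yes y≡b = inj₂ y≡b
... | no y≢a  | no y≢b  = ⊥-elim (∣p∣≤2⇒atMostTwo ∣p∣≤2 y∈p a∈p b∈p y≢a y≢b a≢b)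

∣p∣≤2⇒covered-from : ∀ {n} {p : Subset n} {a} → ∣ p ∣ ≤ 2 → a ∈ p →
  ∃[ b ] (b ∈ p × ∀ y → y ∈ p → y ≡ a ⊎ y ≡ b)
∣p∣≤2⇒covered-from {p = p} {a} ∣p∣≤2 a∈p with any? (λ b → (b ∈? p) ×-dec ¬? (b ≟ a))
... | yes (b , b∈p , b≢a) = b , b∈p , ∣p∣≤2⇒covered ∣p∣≤2 a∈p b∈p (≢-sym b≢a)
... | no ∄b = a , a∈p , only-a
  where
  only-a : ∀ y → y ∈ p → y ≡ a ⊎ y ≡ a
  only-a y y∈p with y ≟ a
  ... | yes y≡a = inj₁ y≡a
  ... | no y≢a  = ⊥-elim (∄b (y , y∈p , y≢a))

covered⇒∣p∣≤2 : ∀ {n} (p : Subset n) (a b : Fin n) → (∀ y → y ∈ p → y ≡ a ⊎ y ≡ b) → ∣ p ∣ ≤ 2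
covered⇒∣p∣≤2 {n} p a b cover = injective-relation⇒∣p∣≤∣q∣ p ⊤ R total injective
  where
  R : Fin n → Fin 2 → Set
  R y zero    = y ≡ a
  R y (suc _) = y ≡ b

  total : ∀ y → y ∈ p → ∃[ t ] (t ∈ ⊤ × R y t)
  total y y∈p with cover y y∈p
  ... | inj₁ y≡a = zero , ∈⊤ , y≡a
  ... | inj₂ y≡b = suc zero , ∈⊤ , y≡b

  injective : ∀ {i j t} → R i t → R j t → i ≡ j
  injective {t = zero}  i≡a j≡a = trans i≡a (sym j≡a)
  injective {t = suc _} i≡b j≡b = trans i≡b (sym j≡b)

atMostTwo⇒labelling : ∀ {n} {E : Fin n → Set} → Decidable E → AtMostTwo E →
  Σ[ t ∈ (Fin n → Fin 2) ] (∀ {i j} → E i → E j → t i ≡ t j → i ≡ j)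
atMostTwo⇒labelling {n} {E} E? atMostTwo with any? E?
... | no ∄E = (λ _ → zero) , λ Ei _ _ → ⊥-elim (∄E (_ , Ei))
... | yes (e , Ee) = t , t-injective
  where
  t : Fin n → Fin 2
  t i = Bool.if does (i ≟ e) then zero else suc zero

  t-injective : ∀ {i j} → E i → E j → t i ≡ t j → i ≡ j
  t-injective {i} {j} Ei Ej ti≡tj with i ≟ e | j ≟ e
  ... | yes i≡e | yes j≡e = trans i≡e (sym j≡e)
  ... | no i≢e  | no j≢e  with i ≟ j
  ...   | yes i≡j = i≡j
  ...   | no i≢j  = ⊥-elim (atMostTwo Ei Ej Ee i≢j i≢e j≢e)

∣p∣≤∣q∣+2 : ∀ {n m} (p : Subset n) (q : Subset m) (R : Fin n → Fin m → Set) {E : Fin n → Set} →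
  Decidable E → AtMostTwo E →
  (∀ i → i ∈ p → E i ⊎ ∃[ x ] (x ∈ q × R i x)) → (∀ {i j x} → R i x → R j x → i ≡ j) →
  ∣ p ∣ ≤ ∣ q ∣ + 2
∣p∣≤∣q∣+2 {n} {m} p q R {E} E? atMostTwo classify injective =
  subst (∣ p ∣ ≤_) (+-comm 2 ∣ q ∣)
    (injective-relation⇒∣p∣≤∣q∣ p (inside ∷ inside ∷ q) R′ total′ (λ {i j y} → injective′ {i} {j} {y}))
  where
  t : Fin n → Fin 2
  t = proj₁ (atMostTwo⇒labelling E? atMostTwo)

  t-injective : ∀ {i j} → E i → E j → t i ≡ t j → i ≡ j
  t-injective = proj₂ (atMostTwo⇒labelling E? atMostTwo)

  R′ : Fin n → Fin (2 + m) → Set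
  R′ i zero          = E i × t i ≡ zero
  R′ i (suc zero)    = E i × t i ≡ suc zero
  R′ i (suc (suc x)) = R i x

  total′ : ∀ i → i ∈ p → ∃[ y ] (y ∈ inside ∷ inside ∷ q × R′ i y)
  total′ i i∈p with classify i i∈p
  ... | inj₂ (x , x∈q , Rix) = suc (suc x) , Vec.there (Vec.there x∈q) , Rix
  ... | inj₁ Ei with t i in ti≡
  ...   | zero     = zero , Vec.here , Ei , ti≡
  ...   | suc zero = suc zero , Vec.there Vec.here , Ei , ti≡

  injective′ : ∀ {i j y} → R′ i y → R′ j y → i ≡ j
  injective′ {y = zero}        (Ei , ti) (Ej , tj) = t-injective Ei Ej (trans ti (sym tj))
  injective′ {y = suc zero}    (Ei , ti) (Ej , tj) = t-injective Ei Ej (trans ti (sym tj))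
  injective′ {y = suc (suc x)} Rix       Rjx       = injective Rix Rjx

Reach-source∈ : ∀ {n} {G : Graph n} {S a b} → Reach G S a b → a ∈ S
Reach-source∈ (here a∈S)     = a∈S
Reach-source∈ (step a∈S _ _) = a∈S

Reach-trans : ∀ {n} {G : Graph n} {S a b c} → Reach G S a b → Reach G S b c → Reach G S a c
Reach-trans (here _)          r′ = r′
Reach-trans (step a∈S a~w r) r′ = step a∈S a~w (Reach-trans r r′)

DominatedByPair : ∀ {n} → Graph n → Fin n → Fin n → Fin n → Set
DominatedByPair G a b y = y ≡ a ⊎ y ≡ b ⊎ y ~[ G ] a ⊎ y ~[ G ] b

PairDominates : ∀ {n} → Graph n → Fin n → Fin n → Set
PairDominates G a b = ∀ y → DominatedByPair G a b y

DominatesAllBut : ∀ {n} → Graph n → Fin n → Fin n → Set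
DominatesAllBut G u v =
  ∃[ x ] (u ~[ G ] x × G x v ≡ false × ∀ y → y ≢ v → DominatedByPair G u x y)

PairDominates-extend : ∀ {n} {G : Graph n} {a b v} →
  (∀ y → y ≢ v → DominatedByPair G a b y) → v ~[ G ] b → PairDominates G a b
PairDominates-extend {v = v} dom v~b y with y ≟ v
... | yes refl = inj₂ (inj₂ (inj₂ v~b))
... | no y≢v   = dom y y≢v

SubgraphPlusEdge : ∀ {n} → Graph n → Graph n → Fin n → Fin n → Set
SubgraphPlusEdge G′ G u v =
  ∀ {x y} → x ~[ G′ ] y → x ~[ G ] y ⊎ (x ≡ u × y ≡ v) ⊎ (x ≡ v × y ≡ u)

SubgraphPlusEdge-swap : ∀ {n} {G′ G : Graph n} {u v} →
  SubgraphPlusEdge G′ G u v → SubgraphPlusEdge G′ G v u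
SubgraphPlusEdge-swap sub x~′y with sub x~′y
... | inj₁ x~y         = inj₁ x~y
... | inj₂ (inj₁ ends) = inj₂ (inj₂ ends)
... | inj₂ (inj₂ ends) = inj₂ (inj₁ ends)

addEdge-subgraphPlusEdge : ∀ {n} (G : Graph n) (u v : Fin n) → SubgraphPlusEdge (addEdge G u v) G u v
addEdge-subgraphPlusEdge G u v {x} {y} e with G x y | x ≟ u | y ≟ v | x ≟ v | y ≟ u
... | true  | _       | _       | _       | _       = inj₁ refl
... | false | yes x≡u | yes y≡v | _       | _       = inj₂ (inj₁ (x≡u , y≡v))
... | false | _       | _       | yes x≡v | yes y≡u = inj₂ (inj₂ (x≡v , y≡u))
... | false | no _    | _       | no _    | _       = case e of λ ()
... | false | no _    | _       | yes _   | no _    = case e of λ ()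
... | false | yes _   | no _    | no _    | _       = case e of λ ()
... | false | yes _   | no _    | yes _   | no _    = case e of λ ()

module _ {n} {G : Graph n} (simple : IsSimple G) where

  ~-sym : ∀ {x y} → x ~[ G ] y → y ~[ G ] x
  ~-sym {x} {y} x~y = trans (proj₁ simple y x) x~y

  ~-irrefl : ∀ {x} → ¬ x ~[ G ] x
  ~-irrefl {x} = not-¬ (proj₂ simple x)

  Reach-sym : ∀ {S a b} → Reach G S a b → Reach G S b a
  Reach-sym (here a∈S)       = here a∈S
  Reach-sym (step a∈S a~w r) = Reach-trans (Reach-sym r) (step (Reach-source∈ r) (~-sym a~w) (here a∈S))

  Reach-within-pair⇒adjacent : ∀ {D a b} → (∀ y → y ∈ D → y ≡ a ⊎ y ≡ b) → a ≢ b →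
    Reach G D a b → a ~[ G ] b
  Reach-within-pair⇒adjacent cover a≢b (here _) = ⊥-elim (a≢b refl)
  Reach-within-pair⇒adjacent cover a≢b (step _ a~w r) with cover _ (Reach-source∈ r)
  ... | inj₁ refl = ⊥-elim (~-irrefl a~w)
  ... | inj₂ refl = a~w

  module _ {G′ : Graph n} {u v : Fin n} (sub : SubgraphPlusEdge G′ G u v) where

    Reach-avoiding : ∀ {D a b} → v ∉ D → Reach G′ D a b → Reach G D a b
    Reach-avoiding v∉D (here a∈D) = here a∈D
    Reach-avoiding v∉D (step a∈D a~′w r) with sub a~′w
    ... | inj₁ a~w              = step a∈D a~w (Reach-avoiding v∉D r)
    ... | inj₂ (inj₁ (_ , refl)) = ⊥-elim (v∉D (Reach-source∈ r))
    ... | inj₂ (inj₂ (refl , _)) = ⊥-elim (v∉D a∈D)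

    dominated-by-cover : ∀ {D a b} → Dominating G′ D → (∀ y → y ∈ D → y ≡ a ⊎ y ≡ b) →
      ∀ y → y ≡ u ⊎ y ≡ v ⊎ DominatedByPair G a b y
    dominated-by-cover dom cover y with dom y
    ... | inj₁ y∈D with cover y y∈D
    ...   | inj₁ y≡a = inj₂ (inj₂ (inj₁ y≡a))
    ...   | inj₂ y≡b = inj₂ (inj₂ (inj₂ (inj₁ y≡b)))
    dominated-by-cover dom cover y | inj₂ (d , d∈D , y~′d) with sub y~′d
    ...   | inj₂ (inj₁ (y≡u , _)) = inj₁ y≡u
    ...   | inj₂ (inj₂ (y≡v , _)) = inj₂ (inj₁ y≡v)
    ...   | inj₁ y~d with cover d d∈D
    ...     | inj₁ refl = inj₂ (inj₂ (inj₂ (inj₂ (inj₁ y~d))))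
    ...     | inj₂ refl = inj₂ (inj₂ (inj₂ (inj₂ (inj₂ y~d))))

    IsCDS-avoiding : ∀ {D} → u ∉ D → v ∉ D → IsCDS G′ D → IsCDS G D
    IsCDS-avoiding {D} u∉D v∉D (dom , conn) = dom′ , λ a b a∈D b∈D → Reach-avoiding v∉D (conn a b a∈D b∈D)
      where
      dom′ : Dominating G D
      dom′ y with dom y
      ... | inj₁ y∈D = inj₁ y∈D
      ... | inj₂ (d , d∈D , y~′d) with sub y~′d
      ...   | inj₁ y~d              = inj₂ (d , d∈D , y~d)
      ...   | inj₂ (inj₁ (_ , refl)) = ⊥-elim (v∉D d∈D)
      ...   | inj₂ (inj₂ (_ , refl)) = ⊥-elim (u∉D d∈D)

    dominated-but-v : ∀ {D x} → Dominating G′ D → (∀ y → y ∈ D → y ≡ u ⊎ y ≡ x) →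
      ∀ y → y ≢ v → DominatedByPair G u x y
    dominated-but-v dom cover y y≢v with dominated-by-cover dom cover y
    ... | inj₁ y≡u        = inj₁ y≡u
    ... | inj₂ (inj₁ y≡v) = ⊥-elim (y≢v y≡v)
    ... | inj₂ (inj₂ y-dominated) = y-dominated

  module _ (connected : Connected G) (γc≥3 : ∀ D → IsCDS G D → 3 ≤ ∣ D ∣) where

    connected⇒neighbour : ∀ {a b} → a ≢ b → ∃[ w ] a ~[ G ] w
    connected⇒neighbour {a} {b} a≢b with connected a b ∈⊤ ∈⊤
    ... | here _         = ⊥-elim (a≢b refl)
    ... | step _ a~w _   = _ , a~w

    ¬dominatingEdge : ∀ {a b} → a ~[ G ] b → ¬ PairDominates G a b
    ¬dominatingEdge {a} {b} a~b dom = ≤⇒≯ (covered⇒∣p∣≤2 D a b cover) (γc≥3 D (dominating , connectedOn))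
      where
      D : Subset n
      D = ⁅ a ⁆ ∪ ⁅ b ⁆

      a∈D : a ∈ D
      a∈D = x∈p∪q⁺ (inj₁ (x∈⁅x⁆ a))

      b∈D : b ∈ D
      b∈D = x∈p∪q⁺ (inj₂ (x∈⁅x⁆ b))

      cover : ∀ y → y ∈ D → y ≡ a ⊎ y ≡ b
      cover y y∈D with x∈p∪q⁻ ⁅ a ⁆ ⁅ b ⁆ y∈D
      ... | inj₁ y∈⁅a⁆ = inj₁ (x∈⁅y⁆⇒x≡y a y∈⁅a⁆)
      ... | inj₂ y∈⁅b⁆ = inj₂ (x∈⁅y⁆⇒x≡y b y∈⁅b⁆)

      dominating : Dominating G D
      dominating y with dom y
      ... | inj₁ refl               = inj₁ a∈D
      ... | inj₂ (inj₁ refl)        = inj₁ b∈D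
      ... | inj₂ (inj₂ (inj₁ y~a)) = inj₂ (a , a∈D , y~a)
      ... | inj₂ (inj₂ (inj₂ y~b)) = inj₂ (b , b∈D , y~b)

      connectedOn : ConnectedOn G D
      connectedOn x y x∈D y∈D with cover x x∈D | cover y y∈D
      ... | inj₁ refl | inj₁ refl = here a∈D
      ... | inj₁ refl | inj₂ refl = step a∈D a~b (here b∈D)
      ... | inj₂ refl | inj₁ refl = step b∈D (~-sym a~b) (here a∈D)
      ... | inj₂ refl | inj₂ refl = here b∈D

    -- Otherwise u and any neighbour w of v would form a dominating edge.
    ¬single-dominates-all-but : ∀ {u v} → u ≢ v → G u v ≡ false →
      ¬ (∀ y → y ≢ v → DominatedByPair G u u y)
    ¬single-dominates-all-but {u} {v} u≢v u≁v dom with connected⇒neighbour (≢-sym u≢v)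
    ... | w , v~w = ¬dominatingEdge (~-sym w~u) (PairDominates-extend dom′ v~w)
      where
      w~u : w ~[ G ] u
      w~u with dom w (λ { refl → ~-irrefl v~w })
      ... | inj₁ refl               = ⊥-elim (not-¬ u≁v (~-sym v~w))
      ... | inj₂ (inj₁ refl)        = ⊥-elim (not-¬ u≁v (~-sym v~w))
      ... | inj₂ (inj₂ (inj₁ w~u)) = w~u
      ... | inj₂ (inj₂ (inj₂ w~u)) = w~u

      dom′ : ∀ y → y ≢ v → DominatedByPair G u w y
      dom′ y y≢v with dom y y≢v
      ... | inj₁ y≡u               = inj₁ y≡u
      ... | inj₂ (inj₁ y≡u)        = inj₁ y≡u
      ... | inj₂ (inj₂ (inj₁ y~u)) = inj₂ (inj₂ (inj₁ y~u))
      ... | inj₂ (inj₂ (inj₂ y~u)) = inj₂ (inj₂ (inj₁ y~u))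

    dominatesAllBut-from-CDS : ∀ {G′ u v D} → SubgraphPlusEdge G′ G u v → u ≢ v → G u v ≡ false →
      IsCDS G′ D → ∣ D ∣ ≤ 2 → u ∈ D → v ∉ D → DominatesAllBut G u v
    dominatesAllBut-from-CDS {u = u} {v} sub u≢v u≁v (dom , conn) ∣D∣≤2 u∈D v∉D
      with ∣p∣≤2⇒covered-from ∣D∣≤2 u∈D
    ... | x , x∈D , cover with u ≟ x
    ...   | yes refl = ⊥-elim (¬single-dominates-all-but u≢v u≁v (dominated-but-v sub dom cover))
    ...   | no u≢x   = x , u~x , ¬-not x≁v , dominated-but-v sub dom cover
      where
      u~x : u ~[ G ] x
      u~x = Reach-within-pair⇒adjacent cover u≢x (Reach-avoiding sub v∉D (conn u x u∈D x∈D))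

      x≁v : ¬ x ~[ G ] v
      x≁v x~v = ¬dominatingEdge u~x (PairDominates-extend (dominated-but-v sub dom cover) (~-sym x~v))

    critical-pair : ∀ {u v} → u ≢ v → G u v ≡ false →
      ∃[ k ] (k < 3 × ConnDomNumber (addEdge G u v) k) →
      PairDominates G u v ⊎ DominatesAllBut G u v ⊎ DominatesAllBut G v u
    critical-pair {u} {v} u≢v u≁v (_ , s≤s ∣D∣≤2 , (D , cds , refl) , _) with u ∈? D | v ∈? D
    ... | yes u∈D | yes v∈D = inj₁ u,v-dominate
      where
      u,v-dominate : PairDominates G u v
      u,v-dominate y with dominated-by-cover (addEdge-subgraphPlusEdge G u v) (proj₁ cds)
                            (∣p∣≤2⇒covered ∣D∣≤2 u∈D v∈D u≢v) y
      ... | inj₁ y≡u               = inj₁ y≡u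
      ... | inj₂ (inj₁ y≡v)        = inj₂ (inj₁ y≡v)
      ... | inj₂ (inj₂ y-dominated) = y-dominated
    ... | yes u∈D | no v∉D = inj₂ (inj₁
      (dominatesAllBut-from-CDS (addEdge-subgraphPlusEdge G u v) u≢v u≁v cds ∣D∣≤2 u∈D v∉D))
    ... | no u∉D | yes v∈D = inj₂ (inj₂
      (dominatesAllBut-from-CDS (SubgraphPlusEdge-swap (addEdge-subgraphPlusEdge G u v))
        (≢-sym u≢v) (trans (proj₁ simple v u) u≁v) cds ∣D∣≤2 v∈D u∉D))
    ... | no u∉D | no v∉D =
      ⊥-elim (≤⇒≯ ∣D∣≤2 (γc≥3 D (IsCDS-avoiding (addEdge-subgraphPlusEdge G u v) u∉D v∉D cds)))

  module _ (critical : ∀ {u v} → u ≢ v → G u v ≡ false →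
                         PairDominates G u v ⊎ DominatesAllBut G u v ⊎ DominatesAllBut G v u)
           {S I : Subset n} {u₀ v₀ : Fin n} (u₀∉S : u₀ ∉ S) (v₀∉S : v₀ ∉ S)
           (separated : ¬ Reach G (∁ S) u₀ v₀) (independent : Independent G I) where

    ¬adjacent-in-I : ∀ {a b} → a ∈ I → b ∈ I → ¬ a ~[ G ] b
    ¬adjacent-in-I a∈I b∈I = not-¬ (independent _ _ a∈I b∈I)

    CoversAllBut : Fin n → Fin n → Set
    CoversAllBut x v = ∀ w → w ∈ I → w ∉ S → w ≢ v → x ~[ G ] w

    PrivateNonNeighbour : Fin n → Fin n → Set
    PrivateNonNeighbour x v = x ∉ I × CoversAllBut x v × G x v ≡ false

    HasPrivateNonNeighbour : Fin n → Set
    HasPrivateNonNeighbour v = ∃[ x ] (x ∈ S × PrivateNonNeighbour x v)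

    Exceptional : Fin n → Set
    Exceptional v = v ∈ I × v ∉ S × ¬ HasPrivateNonNeighbour v

    DominatingEdgeOutside : Fin n → Set
    DominatingEdgeOutside v = ∃[ u ] ∃[ x ]
      (u ∉ S × x ∉ S × u ~[ G ] x × CoversAllBut x v × ∀ y → y ≢ v → DominatedByPair G u x y)

    ¬DominatedByPair-in-I : ∀ {a b c} → a ∈ I → b ∈ I → c ∈ I → c ≢ a → c ≢ b →
      ¬ DominatedByPair G a b c
    ¬DominatedByPair-in-I a∈I b∈I c∈I c≢a c≢b (inj₁ c≡a)               = c≢a c≡a
    ¬DominatedByPair-in-I a∈I b∈I c∈I c≢a c≢b (inj₂ (inj₁ c≡b))        = c≢b c≡b
    ¬DominatedByPair-in-I a∈I b∈I c∈I c≢a c≢b (inj₂ (inj₂ (inj₁ c~a))) = ¬adjacent-in-I c∈I a∈I c~a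
    ¬DominatedByPair-in-I a∈I b∈I c∈I c≢a c≢b (inj₂ (inj₂ (inj₂ c~b))) = ¬adjacent-in-I c∈I b∈I c~b

    dominatesAllBut-covers : ∀ {u x v} → u ∈ I → u ~[ G ] x →
      (∀ y → y ≢ v → DominatedByPair G u x y) → CoversAllBut x v
    dominatesAllBut-covers {u} {x} u∈I u~x dom w w∈I _ w≢v = adjacent (dom w w≢v)
      where
      adjacent : DominatedByPair G u x w → x ~[ G ] w
      adjacent (inj₁ refl)               = ~-sym u~x
      adjacent (inj₂ (inj₁ refl))        = ⊥-elim (¬adjacent-in-I u∈I w∈I u~x)
      adjacent (inj₂ (inj₂ (inj₁ w~u))) = ⊥-elim (¬adjacent-in-I w∈I u∈I w~u)
      adjacent (inj₂ (inj₂ (inj₂ w~x))) = ~-sym w~x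

    dominatesAllBut⇒dominatingEdgeOutside : ∀ {u v} → u ∈ I → u ∉ S →
      ¬ HasPrivateNonNeighbour v → DominatesAllBut G u v → DominatingEdgeOutside v
    dominatesAllBut⇒dominatingEdgeOutside {u} {v} u∈I u∉S ¬private (x , u~x , x≁v , dom) =
      decide-x (x ∈? S)
      where
      covers : CoversAllBut x v
      covers = dominatesAllBut-covers u∈I u~x dom

      decide-x : Dec (x ∈ S) → DominatingEdgeOutside v
      decide-x (yes x∈S) =
        ⊥-elim (¬private (x , x∈S , (λ x∈I → ¬adjacent-in-I u∈I x∈I u~x) , covers , x≁v))
      decide-x (no x∉S)  = u , x , u∉S , x∉S , u~x , covers , dom

    exceptional-pair : ∀ {v v′ c} → Exceptional v → Exceptional v′ → v ≢ v′ →
      c ∈ I → c ≢ v → c ≢ v′ → DominatingEdgeOutside v ⊎ DominatingEdgeOutside v′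
    exceptional-pair {c = c} (v∈I , v∉S , ¬privateᵥ) (v′∈I , v′∉S , ¬privateᵥ′) v≢v′ c∈I c≢v c≢v′
      with critical v≢v′ (independent _ _ v∈I v′∈I)
    ... | inj₁ dominates = ⊥-elim (¬DominatedByPair-in-I v∈I v′∈I c∈I c≢v c≢v′ (dominates c))
    ... | inj₂ (inj₁ v-dominates)  =
      inj₂ (dominatesAllBut⇒dominatingEdgeOutside v∈I v∉S ¬privateᵥ′ v-dominates)
    ... | inj₂ (inj₂ v′-dominates) =
      inj₁ (dominatesAllBut⇒dominatingEdgeOutside v′∈I v′∉S ¬privateᵥ v′-dominates)

    dominatingEdgeOutside⇒Reach : ∀ {v c} → DominatingEdgeOutside v → c ∈ I → c ∉ S → c ≢ v →
      ∀ z → z ∉ S → z ≢ v → Reach G (∁ S) z c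
    dominatingEdgeOutside⇒Reach {c = c} (u , x , u∉S , x∉S , u~x , covers , dom) c∈I c∉S c≢v z z∉S z≢v =
      reach (dom z z≢v)
      where
      x⇝c : Reach G (∁ S) x c
      x⇝c = step (x∉p⇒x∈∁p x∉S) (covers c c∈I c∉S c≢v) (here (x∉p⇒x∈∁p c∉S))

      u⇝c : Reach G (∁ S) u c
      u⇝c = step (x∉p⇒x∈∁p u∉S) u~x x⇝c

      reach : DominatedByPair G u x z → Reach G (∁ S) z c
      reach (inj₁ refl)               = u⇝c
      reach (inj₂ (inj₁ refl))        = x⇝c
      reach (inj₂ (inj₂ (inj₁ z~u))) = step (x∉p⇒x∈∁p z∉S) z~u u⇝c
      reach (inj₂ (inj₂ (inj₂ z~x))) = step (x∉p⇒x∈∁p z∉S) z~x x⇝c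

    ¬two-dominatingEdgesOutside : ∀ {v v′ c} → DominatingEdgeOutside v → DominatingEdgeOutside v′ →
      v ≢ v′ → c ∈ I → c ∉ S → c ≢ v → c ≢ v′ → ⊥
    ¬two-dominatingEdgesOutside {v} {c = c} e e′ v≢v′ c∈I c∉S c≢v c≢v′ =
      separated (Reach-trans (⇝c u₀ u₀∉S) (Reach-sym (⇝c v₀ v₀∉S)))
      where
      ⇝c : ∀ z → z ∉ S → Reach G (∁ S) z c
      ⇝c z z∉S with z ≟ v
      ... | yes refl = dominatingEdgeOutside⇒Reach e′ c∈I c∉S c≢v′ z z∉S v≢v′
      ... | no z≢v   = dominatingEdgeOutside⇒Reach e c∈I c∉S c≢v z z∉S z≢v

    exceptional-atMostTwo : AtMostTwo Exceptional
    exceptional-atMostTwo E₁@(i₁ , s₁ , _) E₂@(i₂ , s₂ , _) E₃@(i₃ , s₃ , _) 1≢2 1≢3 2≢3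
      with exceptional-pair E₁ E₂ 1≢2 i₃ (≢-sym 1≢3) (≢-sym 2≢3)
    ... | inj₁ e₁ with exceptional-pair E₂ E₃ 2≢3 i₁ 1≢2 1≢3
    ...   | inj₁ e₂ = ¬two-dominatingEdgesOutside e₁ e₂ 1≢2 i₃ s₃ (≢-sym 1≢3) (≢-sym 2≢3)
    ...   | inj₂ e₃ = ¬two-dominatingEdgesOutside e₁ e₃ 1≢3 i₂ s₂ (≢-sym 1≢2) 2≢3
    exceptional-atMostTwo E₁@(i₁ , s₁ , _) E₂@(i₂ , s₂ , _) E₃@(i₃ , s₃ , _) 1≢2 1≢3 2≢3
      | inj₂ e₂ with exceptional-pair E₁ E₃ 1≢3 i₂ (≢-sym 1≢2) 2≢3
    ...   | inj₁ e₁ = ¬two-dominatingEdgesOutside e₁ e₂ 1≢2 i₃ s₃ (≢-sym 1≢3) (≢-sym 2≢3)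
    ...   | inj₂ e₃ = ¬two-dominatingEdgesOutside e₂ e₃ 2≢3 i₁ s₁ 1≢2 1≢3

    hasPrivateNonNeighbour? : Decidable HasPrivateNonNeighbour
    hasPrivateNonNeighbour? v = any? λ x →
      (x ∈? S) ×-dec ¬? (x ∈? I)
        ×-dec all? (λ w → (w ∈? I) →-dec ¬? (w ∈? S) →-dec ¬? (w ≟ v) →-dec (G x w Bool.≟ true))
        ×-dec (G x v Bool.≟ false)

    exceptional? : Decidable Exceptional
    exceptional? v = (v ∈? I) ×-dec ¬? (v ∈? S) ×-dec ¬? (hasPrivateNonNeighbour? v)

    RepresentedBy : Fin n → Fin n → Set
    RepresentedBy v x = v ∈ I × (x ≡ v ⊎ (v ∉ S × PrivateNonNeighbour x v))

    representative : ∀ v → v ∈ I → Exceptional v ⊎ ∃[ x ] (x ∈ S × RepresentedBy v x)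
    representative v v∈I with v ∈? S | hasPrivateNonNeighbour? v
    ... | yes v∈S | _                         = inj₂ (v , v∈S , v∈I , inj₁ refl)
    ... | no v∉S  | yes (x , x∈S , x-private) = inj₂ (x , x∈S , v∈I , inj₂ (v∉S , x-private))
    ... | no v∉S  | no ¬private              = inj₁ (v∈I , v∉S , ¬private)

    RepresentedBy-injective : ∀ {i j x} → RepresentedBy i x → RepresentedBy j x → i ≡ j
    RepresentedBy-injective (_ , inj₁ refl) (_ , inj₁ refl) = refl
    RepresentedBy-injective (i∈I , inj₁ refl) (_ , inj₂ (_ , x∉I , _)) = ⊥-elim (x∉I i∈I)
    RepresentedBy-injective (_ , inj₂ (_ , x∉I , _)) (j∈I , inj₁ refl) = ⊥-elim (x∉I j∈I)
    RepresentedBy-injective {i} {j} (_ , inj₂ (_ , _ , coversᵢ , _)) (j∈I , inj₂ (j∉S , _ , _ , x≁j))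
      with i ≟ j
    ... | yes i≡j = i≡j
    ... | no i≢j  = ⊥-elim (not-¬ x≁j (coversᵢ _ j∈I j∉S (≢-sym i≢j)))

    ∣I∣≤∣S∣+2 : ∣ I ∣ ≤ ∣ S ∣ + 2
    ∣I∣≤∣S∣+2 = ∣p∣≤∣q∣+2 I S RepresentedBy exceptional? exceptional-atMostTwo
      representative RepresentedBy-injective

theorem3p2 : ∀ (n : ℕ) (G : Graph n) → IsSimple G → Connected G → Is3CCritical G →
    ∀ (a k : ℕ) → IndepNumber G a → Connectivity G k → a ≤ k + 2
theorem3p2 n G simple connected ((_ , γc≥3) , critical) a k ((I , independent , refl) , _)
  ((S , (u₀ , v₀ , u₀∉S , v₀∉S , separated) , refl) , _) =
  ∣I∣≤∣S∣+2 simple critical-pair′ u₀∉S v₀∉S separated independent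
  where
  critical-pair′ : ∀ {u v} → u ≢ v → G u v ≡ false →
    PairDominates G u v ⊎ DominatesAllBut G u v ⊎ DominatesAllBut G v u
  critical-pair′ u≢v u≁v = critical-pair simple connected γc≥3 u≢v u≁v (critical _ _ u≢v u≁v)
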